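{- Let $m\ge3$ be an integer with $m\notin\{3,4,6,8,10,12,14,18,20,24,30,36,42,60\}$. Then $\varphi(m)>m^{0.7}$.
   Context: $\varphi$ denotes Euler's totient function. -}

module Defs where

open import Data.Nat using (ℕ; suc)
open import Data.Nat.Coprimality using (Coprime; coprime?)
open import Data.List using (List; length; filter; upTo; map)

oneTo : ℕ → List ℕ
oneTo m = map suc (upTo m)

φ : ℕ → ℕ
φ m = length (filter (λ k → coprime? k m) (oneTo m))

-- The ratio φ(n)^10 / n^7 is multiplicative, and on a prime power p^e (e ≥ 1) it equals
-- (p - 1)^10 p^(3e - 10): at least 513 for every prime p ≥ 11, and non-decreasing in e.
-- Write m = 2^a 3^b 5^c 7^d n with n free of primes below 11.  The contribution of n is
-- 1 if n = 1 and at least 513 otherwise, and the contributions of 2, 3, 5, 7 are bounded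
-- below by their values at the capped exponents a ⊓ 4, b ⊓ 3, c ⊓ 2, d ⊓ 2.  The theorem
-- thus reduces to a finite computation, whose only failures are the listed values of m.
-- Multiplicativity is used only in the two forms φ(p y) = p φ(y) for p ∣ y and
-- φ(p y) = (p - 1) φ(y) for a prime p ∤ y, both proved by counting residues.
module Submission where

open import Defs
open import Data.Nat using (ℕ; _≤_; _<_; _^_)
open import Data.List using (_∷_; [])
open import Data.List.Membership.Propositional using (_∈_)
open import Relation.Nullary using (¬_)

open import Algebra.Properties.CommutativeSemigroup using (interchange)
open import Data.Bool.Base using (Bool; true; false; _∧_; not)
open import Data.List.Base using (List; length; filter; applyUpTo)
open import Data.List.Properties using (map-upTo)
open import Data.List.Relation.Unary.All using (All; []; _∷_)
open import Data.List.Relation.Unary.Any using (here; there)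
open import Data.Nat.Base
open import Data.Nat.Properties
open import Data.Nat.Divisibility
open import Data.List.Membership.DecPropositional _≟_ using (_∈?_)
open import Data.Nat.Coprimality using (Coprime; coprime?; coprime-divisor; coprime-+)
  renaming (sym to coprime-sym)
open import Data.Nat.Induction using (<-wellFounded)
open import Data.Nat.ListAction using (product)
open import Data.Nat.Primality
  using (Prime; Composite; _Rough_; prime?; composite?; prime[2]; composite[4]; composite[6];
         prime⇒irreducible; prime⇒nonZero; prime⇒nonTrivial; ¬prime[0]; ¬prime[1];
         2-rough; rough⇒≤; rough∧∣⇒rough; ∤⇒rough-suc)
open import Data.Nat.Primality.Factorisation using (factorise)
open import Data.Nat.Solver using (module +-*-Solver)
open import Data.Product.Base using (∃₂; _×_; _,_; proj₂)
open import Data.Product.Function.NonDependent.Propositional using (_×-⇔_)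
open import Data.Sum.Base using (_⊎_; inj₁; inj₂; [_,_]′)
open import Data.Unit.Base using (tt)
open import Function.Base using (_∘_)
open import Function.Bundles using (_⇔_; mk⇔; module Equivalence)
open import Function.Construct.Composition using (_⇔-∘_)
open import Function.Construct.Identity using (⇔-id)
open import Induction.WellFounded using (Acc; acc)
open import Relation.Binary.PropositionalEquality hiding ([_])
open import Relation.Nullary.Decidable
  using (Dec; yes; no; does; dec-true; dec-false; does-⇔; from-yes; _×-dec_; _⊎-dec_; ¬?)
open import Relation.Nullary.Negation using (contradiction)
open +-*-Solver using (solve; _:*_; _:^_; _:=_)

toℕ : Bool → ℕ
toℕ false = 0
toℕ true  = 1

count : ℕ → (ℕ → Bool) → ℕ
count zero    f = 0
count (suc n) f = toℕ (f 0) + count n (f ∘ suc)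

count-cong : ∀ {f g} → (∀ i → f i ≡ g i) → ∀ n → count n f ≡ count n g
count-cong f≗g zero    = refl
count-cong f≗g (suc n) = cong₂ _+_ (cong toℕ (f≗g 0)) (count-cong (f≗g ∘ suc) n)

count-+ : ∀ m n f → count (m + n) f ≡ count m f + count n (f ∘ (m +_))
count-+ zero    n f = refl
count-+ (suc m) n f = trans (cong (toℕ (f 0) +_) (count-+ m n (f ∘ suc)))
                            (sym (+-assoc (toℕ (f 0)) _ _))

count-periodic : ∀ {f} y → (∀ i → f (y + i) ≡ f i) → ∀ t → count (t * y) f ≡ t * count y f
count-periodic y f-per zero    = refl
count-periodic {f} y f-per (suc t) = begin
  count (y + t * y) f                     ≡⟨ count-+ y (t * y) f ⟩
  count y f + count (t * y) (f ∘ (y +_))  ≡⟨ cong (count y f +_) (count-cong f-per (t * y)) ⟩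
  count y f + count (t * y) f             ≡⟨ cong (count y f +_) (count-periodic y f-per t) ⟩
  count y f + t * count y f               ∎
  where open ≡-Reasoning

toℕ-split : ∀ b a → toℕ (b ∧ a) + toℕ (not b ∧ a) ≡ toℕ a
toℕ-split true  a = +-identityʳ (toℕ a)
toℕ-split false a = refl

count-split : ∀ g f n → count n (λ i → g i ∧ f i) + count n (λ i → not (g i) ∧ f i) ≡ count n f
count-split g f zero    = refl
count-split g f (suc n) =
  trans (interchange +-commutativeSemigroup (toℕ (g 0 ∧ f 0)) _ (toℕ (not (g 0) ∧ f 0)) _)
        (cong₂ _+_ (toℕ-split (g 0) (f 0)) (count-split (g ∘ suc) (f ∘ suc) n))

count-none : ∀ {f} n → (∀ {i} → i < n → f i ≡ false) → count n f ≡ 0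
count-none zero    f≡false = refl
count-none (suc n) f≡false rewrite f≡false z<s = count-none n (f≡false ∘ s<s)

count-last : ∀ n f → count (suc n) f ≡ count n f + toℕ (f n)
count-last n f = begin
  count (suc n) f                    ≡⟨ cong (λ k → count k f) (+-comm 1 n) ⟩
  count (n + 1) f                    ≡⟨ count-+ n 1 f ⟩
  count n f + (toℕ (f (n + 0)) + 0)  ≡⟨ cong (count n f +_) (trans (+-identityʳ _) (cong (toℕ ∘ f) (+-identityʳ n))) ⟩
  count n f + toℕ (f n)              ∎
  where open ≡-Reasoning

module _ (q : ℕ) where

  private
    p = suc q

    multiple? : ℕ → Bool
    multiple? k = does (p ∣? k)

  count-multiples-period : ∀ (Q : ℕ → Bool) → count p (λ i → multiple? (suc i) ∧ Q (suc i)) ≡ toℕ (Q p)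
  count-multiples-period Q = begin
    count p f                ≡⟨ count-last q f ⟩
    count q f + toℕ (f q)    ≡⟨ cong (_+ toℕ (f q)) (count-none q f≡false) ⟩
    toℕ (multiple? p ∧ Q p)  ≡⟨ cong (λ b → toℕ (b ∧ Q p)) (dec-true (p ∣? p) ∣-refl) ⟩
    toℕ (Q p)                ∎
    where
    open ≡-Reasoning
    f : ℕ → Bool
    f i = multiple? (suc i) ∧ Q (suc i)
    f≡false : ∀ {i} → i < q → f i ≡ false
    f≡false {i} i<q = cong (_∧ Q (suc i)) (dec-false (p ∣? suc i) (λ p∣1+i → <⇒≱ (s<s i<q) (∣⇒≤ p∣1+i)))

  count-multiples : ∀ (Q : ℕ → Bool) y →
                    count (y * p) (λ i → multiple? (suc i) ∧ Q (suc i)) ≡ count y (λ j → Q (p * suc j))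
  count-multiples Q zero    = refl
  count-multiples Q (suc y) = begin
    count (p + y * p) f
      ≡⟨ count-+ p (y * p) f ⟩
    count p f + count (y * p) (f ∘ (p +_))
      ≡⟨ cong₂ _+_ (count-multiples-period Q) (count-cong shift (y * p)) ⟩
    toℕ (Q p) + count (y * p) (λ i → multiple? (suc i) ∧ Q (p + suc i))
      ≡⟨ cong₂ _+_ (cong (toℕ ∘ Q) (sym (*-identityʳ p))) (count-multiples (Q ∘ (p +_)) y) ⟩
    toℕ (Q (p * 1)) + count y (λ j → Q (p + p * suc j))
      ≡⟨ cong (toℕ (Q (p * 1)) +_) (count-cong (cong Q ∘ sym ∘ *-suc p ∘ suc) y) ⟩
    count (suc y) (λ j → Q (p * suc j))
      ∎
    where
    open ≡-Reasoning
    f : ℕ → Bool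
    f i = multiple? (suc i) ∧ Q (suc i)
    p∣p+k⇔p∣k : ∀ {k} → p ∣ p + k ⇔ p ∣ k
    p∣p+k⇔p∣k = mk⇔ (λ p∣p+k → ∣m+n∣m⇒∣n p∣p+k ∣-refl) (∣m∣n⇒∣m+n ∣-refl)
    shift : ∀ i → f (p + i) ≡ multiple? (suc i) ∧ Q (p + suc i)
    shift i = cong₂ _∧_ (trans (cong multiple? (sym (+-suc p i))) (does-⇔ p∣p+k⇔p∣k (p ∣? p + suc i) (p ∣? suc i)))
                        (cong Q (sym (+-suc p i)))

coprime-∣ˡ : ∀ {m n d} → Coprime m n → d ∣ m → Coprime d n
coprime-∣ˡ c d∣m (i∣d , i∣n) = c (∣-trans i∣d d∣m , i∣n)

coprime-∣ʳ : ∀ {m n d} → Coprime m n → d ∣ n → Coprime m d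
coprime-∣ʳ c d∣n (i∣m , i∣d) = c (i∣m , ∣-trans i∣d d∣n)

coprime-*ʳ : ∀ {k m n} → Coprime k (m * n) ⇔ (Coprime k m × Coprime k n)
coprime-*ʳ {k} {m} {n} = mk⇔ split join
  where
  split : Coprime k (m * n) → Coprime k m × Coprime k n
  split c = coprime-∣ʳ c (m∣m*n n) , coprime-∣ʳ c (n∣m*n m)
  join : Coprime k m × Coprime k n → Coprime k (m * n)
  join (km , kn) (i∣k , i∣mn) = kn (i∣k , coprime-divisor (coprime-∣ˡ km i∣k) i∣mn)

coprime-*ˡ : ∀ {k m n} → Coprime (m * n) k ⇔ (Coprime m k × Coprime n k)
coprime-*ˡ {k} {m} {n} = mk⇔ split join
  where
  split : Coprime (m * n) k → Coprime m k × Coprime n k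
  split c = coprime-∣ˡ c (m∣m*n n) , coprime-∣ˡ c (n∣m*n m)
  join : Coprime m k × Coprime n k → Coprime (m * n) k
  join (mk , nk) (i∣mn , i∣k) = nk (coprime-divisor (coprime-sym (coprime-∣ʳ mk i∣k)) i∣mn , i∣k)

coprime-+ʳ : ∀ {k n} → Coprime (k + n) n ⇔ Coprime k n
coprime-+ʳ {k} {n} = mk⇔ drop (subst (λ j → Coprime j n) (+-comm n k) ∘ coprime-+)
  where
  drop : Coprime (k + n) n → Coprime k n
  drop c (i∣k , i∣n) = c (∣m∣n⇒∣m+n i∣k i∣n , i∣n)

prime-coprime⇔∤ : ∀ {p k} → Prime p → Coprime k p ⇔ (¬ p ∣ k)
prime-coprime⇔∤ {p} {k} pr = mk⇔ coprime⇒∤ ∤⇒coprime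
  where
  coprime⇒∤ : Coprime k p → ¬ p ∣ k
  coprime⇒∤ c p∣k = ¬prime[1] (subst Prime (c (p∣k , ∣-refl)) pr)
  ∤⇒coprime : ¬ p ∣ k → Coprime k p
  ∤⇒coprime p∤k (i∣k , i∣p) with prime⇒irreducible pr i∣p
  ... | inj₁ i≡1  = i≡1
  ... | inj₂ refl = contradiction i∣k p∤k

coprimeTo : ℕ → ℕ → Bool
coprimeTo n k = does (coprime? k n)

length-filter-applyUpTo : ∀ {P : ℕ → Set} (P? : ∀ k → Dec (P k)) f n →
                          length (filter P? (applyUpTo f n)) ≡ count n (λ i → does (P? (f i)))
length-filter-applyUpTo P? f zero = refl
length-filter-applyUpTo P? f (suc n) with does (P? (f 0))
... | true  = cong suc (length-filter-applyUpTo P? (f ∘ suc) n)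
... | false = length-filter-applyUpTo P? (f ∘ suc) n

φ≡count : ∀ m → φ m ≡ count m (coprimeTo m ∘ suc)
φ≡count m = trans (cong (length ∘ filter (λ k → coprime? k m)) (map-upTo suc m))
                  (length-filter-applyUpTo (λ k → coprime? k m) suc m)

count-coprimeTo : ∀ y t → count (t * y) (coprimeTo y ∘ suc) ≡ t * φ y
count-coprimeTo y t = trans (count-periodic y shift t) (cong (t *_) (sym (φ≡count y)))
  where
  shift : ∀ i → coprimeTo y (suc (y + i)) ≡ coprimeTo y (suc i)
  shift i = trans (cong (coprimeTo y ∘ suc) (+-comm y i))
                  (does-⇔ coprime-+ʳ (coprime? (suc i + y) y) (coprime? (suc i) y))

φ-*-∣ : ∀ {p y} → p ∣ y → φ (p * y) ≡ p * φ y
φ-*-∣ {p} {y} p∣y = begin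
  φ (p * y)                                ≡⟨ φ≡count (p * y) ⟩
  count (p * y) (coprimeTo (p * y) ∘ suc)  ≡⟨ count-cong coprimeTo-p*y≗y (p * y) ⟩
  count (p * y) (coprimeTo y ∘ suc)        ≡⟨ count-coprimeTo y p ⟩
  p * φ y                                  ∎
  where
  open ≡-Reasoning
  coprime-p*y⇔y : ∀ {k} → Coprime k (p * y) ⇔ Coprime k y
  coprime-p*y⇔y {k} = mk⇔ (proj₂ ∘ Equivalence.to (coprime-*ʳ {k} {p} {y}))
                          (λ c → Equivalence.from (coprime-*ʳ {k} {p} {y}) (coprime-∣ʳ c p∣y , c))
  coprimeTo-p*y≗y : ∀ i → coprimeTo (p * y) (suc i) ≡ coprimeTo y (suc i)
  coprimeTo-p*y≗y i = does-⇔ coprime-p*y⇔y (coprime? (suc i) (p * y)) (coprime? (suc i) y)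

-- Among 1, …, p y, those coprime to y number p φ(y); the ones divisible by p are p j with
-- j coprime to y, so φ(y) of them, and the others are exactly those coprime to p y.
φ-*-∤-+ : ∀ {p y} → Prime p → ¬ p ∣ y → φ (p * y) + φ y ≡ p * φ y
φ-*-∤-+ {zero}          pr _   = contradiction pr ¬prime[0]
φ-*-∤-+ {p@(suc q)} {y} pr p∤y = begin
  φ (p * y) + φ y                                                          ≡⟨ cong₂ _+_ φ[p*y]≡ φ[y]≡ ⟩
  count (p * y) (λ i → not (B i) ∧ A i) + count (p * y) (λ i → B i ∧ A i)  ≡⟨ +-comm (count (p * y) _) _ ⟩
  count (p * y) (λ i → B i ∧ A i) + count (p * y) (λ i → not (B i) ∧ A i)  ≡⟨ count-split B A (p * y) ⟩
  count (p * y) A                                                          ≡⟨ count-coprimeTo y p ⟩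
  p * φ y                                                                  ∎
  where
  open ≡-Reasoning
  A B : ℕ → Bool
  A i = coprimeTo y (suc i)
  B i = does (p ∣? suc i)
  φ[p*y]≡ : φ (p * y) ≡ count (p * y) (λ i → not (B i) ∧ A i)
  φ[p*y]≡ = trans (φ≡count (p * y)) (count-cong (λ i →
    does-⇔ ((prime-coprime⇔∤ pr ×-⇔ ⇔-id _) ⇔-∘ coprime-*ʳ {suc i} {p} {y})
           (coprime? (suc i) (p * y)) (¬? (p ∣? suc i) ×-dec coprime? (suc i) y)) (p * y))
  coprime[p,y] : Coprime p y
  coprime[p,y] = coprime-sym (Equivalence.from (prime-coprime⇔∤ pr) p∤y)
  coprime-p*j⇔j : ∀ {j} → Coprime (p * j) y ⇔ Coprime j y
  coprime-p*j⇔j {j} = mk⇔ (proj₂ ∘ Equivalence.to (coprime-*ˡ {y} {p} {j}))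
                          (λ c → Equivalence.from (coprime-*ˡ {y} {p} {j}) (coprime[p,y] , c))
  coprimeTo-p*j≗j : ∀ j → coprimeTo y (p * suc j) ≡ coprimeTo y (suc j)
  coprimeTo-p*j≗j j = does-⇔ coprime-p*j⇔j (coprime? (p * suc j) y) (coprime? (suc j) y)
  φ[y]≡ : φ y ≡ count (p * y) (λ i → B i ∧ A i)
  φ[y]≡ = sym (begin
    count (p * y) (λ i → B i ∧ A i)          ≡⟨ cong (λ n → count n (λ i → B i ∧ A i)) (*-comm p y) ⟩
    count (y * p) (λ i → B i ∧ A i)          ≡⟨ count-multiples q (coprimeTo y) y ⟩
    count y (λ j → coprimeTo y (p * suc j))  ≡⟨ count-cong coprimeTo-p*j≗j y ⟩
    count y (coprimeTo y ∘ suc)              ≡⟨ φ≡count y ⟨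
    φ y                                      ∎)

φ-*-∤ : ∀ {p y} → Prime p → ¬ p ∣ y → φ (p * y) ≡ (p ∸ 1) * φ y
φ-*-∤ {p} {y} pr p∤y = begin
  φ (p * y)              ≡⟨ m+n∸n≡m (φ (p * y)) (φ y) ⟨
  φ (p * y) + φ y ∸ φ y  ≡⟨ cong (_∸ φ y) (φ-*-∤-+ pr p∤y) ⟩
  p * φ y ∸ φ y          ≡⟨ cong (p * φ y ∸_) (*-identityˡ (φ y)) ⟨
  p * φ y ∸ 1 * φ y      ≡⟨ *-distribʳ-∸ (φ y) p 1 ⟨
  (p ∸ 1) * φ y          ∎
  where open ≡-Reasoning

^-distribʳ-* : ∀ m n k → (m * n) ^ k ≡ m ^ k * n ^ k
^-distribʳ-* m n zero    = refl
^-distribʳ-* m n (suc k) = trans (cong (m * n *_) (^-distribʳ-* m n k)) (interchange *-commutativeSemigroup m n (m ^ k) (n ^ k))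

record TotientRatio≥ (α β num den n : ℕ) : Set where
  constructor totientRatio≥
  field cross : num * n ^ α ≤ den * φ n ^ β

-- φ(p^(e+1))^β / p^((e+1)α) = (p - 1)^β p^(e(β - α)) / p^α.
primePowerNum : (α β p e : ℕ) → ℕ
primePowerNum α β p zero    = 1
primePowerNum α β p (suc e) = (p ∸ 1) ^ β * p ^ (e * (β ∸ α))

primePowerDen : (α p e : ℕ) → ℕ
primePowerDen α p zero    = 1
primePowerDen α p (suc e) = p ^ α

module _ {α β : ℕ} where

  ratio-cong : ∀ {num num′ den den′ n n′} → num ≡ num′ → den ≡ den′ → n ≡ n′ →
               TotientRatio≥ α β num den n → TotientRatio≥ α β num′ den′ n′
  ratio-cong refl refl refl h = h

  ratio-1 : TotientRatio≥ α β 1 1 1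
  ratio-1 = totientRatio≥ (≤-reflexive (trans (*-identityˡ (1 ^ α))
                                              (trans (^-zeroˡ α) (sym (trans (*-identityˡ (1 ^ β)) (^-zeroˡ β))))))

  ratio-weakenˡ : ∀ {num num′ den n} → num′ ≤ num → TotientRatio≥ α β num den n → TotientRatio≥ α β num′ den n
  ratio-weakenˡ {n = n} num′≤num (totientRatio≥ h) = totientRatio≥ (≤-trans (*-monoˡ-≤ (n ^ α) num′≤num) h)

  ratio-scale : ∀ {num den c n} .{{_ : NonZero den}} → c * den ≤ num →
                TotientRatio≥ α β num den n → TotientRatio≥ α β c 1 n
  ratio-scale {num} {den} {c} {n} c*den≤num (totientRatio≥ h) = totientRatio≥ (*-cancelˡ-≤ den (begin
    den * (c * n ^ α)    ≡⟨ solve 3 (λ x y z → x :* (y :* z) := y :* x :* z) refl den c (n ^ α) ⟩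
    c * den * n ^ α      ≤⟨ *-monoˡ-≤ (n ^ α) c*den≤num ⟩
    num * n ^ α          ≤⟨ h ⟩
    den * φ n ^ β        ≡⟨ cong (den *_) (*-identityˡ (φ n ^ β)) ⟨
    den * (1 * φ n ^ β)  ∎))
    where open ≤-Reasoning

  ratio⇒< : ∀ {num den m} .{{_ : NonZero m}} → TotientRatio≥ α β num den m → den < num → m ^ α < φ m ^ β
  ratio⇒< {num} {den} {m} (totientRatio≥ h) den<num = *-cancelˡ-< den (m ^ α) (φ m ^ β) (begin-strict
    den * m ^ α    <⟨ *-monoˡ-< (m ^ α) {{m^n≢0 m α}} den<num ⟩
    num * m ^ α    ≤⟨ h ⟩
    den * φ m ^ β  ∎)
    where open ≤-Reasoning

  ratio-*-∣ : ∀ {p y num den} → α ≤ β → p ∣ y → TotientRatio≥ α β num den y →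
              TotientRatio≥ α β (num * p ^ (β ∸ α)) den (p * y)
  ratio-*-∣ {p} {y} {num} {den} α≤β p∣y (totientRatio≥ h) = totientRatio≥ (begin
    num * p ^ (β ∸ α) * (p * y) ^ α      ≡⟨ cong (num * p ^ (β ∸ α) *_) (^-distribʳ-* p y α) ⟩
    num * p ^ (β ∸ α) * (p ^ α * y ^ α)  ≡⟨ shuffle num (p ^ (β ∸ α)) (p ^ α) (y ^ α) ⟩
    p ^ (β ∸ α) * p ^ α * (num * y ^ α)  ≡⟨ cong (_* (num * y ^ α)) p^β-split ⟨
    p ^ β * (num * y ^ α)                ≤⟨ *-monoʳ-≤ (p ^ β) h ⟩
    p ^ β * (den * φ y ^ β)              ≡⟨ x*[y*z]≡y*[x*z] (p ^ β) den (φ y ^ β) ⟩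
    den * (p ^ β * φ y ^ β)              ≡⟨ cong (den *_) (^-distribʳ-* p (φ y) β) ⟨
    den * (p * φ y) ^ β                  ≡⟨ cong (λ x → den * x ^ β) (φ-*-∣ p∣y) ⟨
    den * φ (p * y) ^ β                  ∎)
    where
    open ≤-Reasoning
    shuffle : ∀ a q r s → a * q * (r * s) ≡ q * r * (a * s)
    shuffle = solve 4 (λ a q r s → a :* q :* (r :* s) := q :* r :* (a :* s)) refl
    x*[y*z]≡y*[x*z] : ∀ x y z → x * (y * z) ≡ y * (x * z)
    x*[y*z]≡y*[x*z] = solve 3 (λ x y z → x :* (y :* z) := y :* (x :* z)) refl
    p^β-split : p ^ β ≡ p ^ (β ∸ α) * p ^ α
    p^β-split = trans (cong (p ^_) (sym (m∸n+n≡m α≤β))) (^-distribˡ-+-* p (β ∸ α) α)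

  ratio-*-∣′ : ∀ {p y num den} .{{_ : NonZero p}} → α ≤ β → p ∣ y →
               TotientRatio≥ α β num den y → TotientRatio≥ α β num den (p * y)
  ratio-*-∣′ {p} {num = num} α≤β p∣y h =
    ratio-weakenˡ (m≤m*n num (p ^ (β ∸ α)) {{m^n≢0 p (β ∸ α)}}) (ratio-*-∣ α≤β p∣y h)

  ratio-*-∤ : ∀ {p y num den} → Prime p → ¬ p ∣ y → TotientRatio≥ α β num den y →
              TotientRatio≥ α β (num * (p ∸ 1) ^ β) (den * p ^ α) (p * y)
  ratio-*-∤ {p} {y} {num} {den} pr p∤y (totientRatio≥ h) = totientRatio≥ (begin
    num * (p ∸ 1) ^ β * (p * y) ^ α        ≡⟨ cong (num * (p ∸ 1) ^ β *_) (^-distribʳ-* p y α) ⟩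
    num * (p ∸ 1) ^ β * (p ^ α * y ^ α)    ≡⟨ shuffle num ((p ∸ 1) ^ β) (p ^ α) (y ^ α) ⟩
    (p ∸ 1) ^ β * p ^ α * (num * y ^ α)    ≤⟨ *-monoʳ-≤ ((p ∸ 1) ^ β * p ^ α) h ⟩
    (p ∸ 1) ^ β * p ^ α * (den * φ y ^ β)  ≡⟨ unshuffle ((p ∸ 1) ^ β) (p ^ α) den (φ y ^ β) ⟩
    den * p ^ α * ((p ∸ 1) ^ β * φ y ^ β)  ≡⟨ cong (den * p ^ α *_) (^-distribʳ-* (p ∸ 1) (φ y) β) ⟨
    den * p ^ α * ((p ∸ 1) * φ y) ^ β      ≡⟨ cong (λ x → den * p ^ α * x ^ β) (φ-*-∤ pr p∤y) ⟨
    den * p ^ α * φ (p * y) ^ β            ∎)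
    where
    open ≤-Reasoning
    shuffle : ∀ a q r s → a * q * (r * s) ≡ q * r * (a * s)
    shuffle = solve 4 (λ a q r s → a :* q :* (r :* s) := q :* r :* (a :* s)) refl
    unshuffle : ∀ q r d f → q * r * (d * f) ≡ d * r * (q * f)
    unshuffle = solve 4 (λ q r d f → q :* r :* (d :* f) := d :* r :* (q :* f)) refl

  ratio-*-prime^ : ∀ {p y num den} → Prime p → ¬ p ∣ y → α ≤ β → TotientRatio≥ α β num den y → ∀ e →
                   TotientRatio≥ α β (num * primePowerNum α β p (suc e)) (den * primePowerDen α p (suc e)) (p ^ suc e * y)
  ratio-*-prime^ {p} {y} {num} {den} pr p∤y α≤β h zero =
    ratio-cong (cong (num *_) (sym (*-identityʳ _))) refl (cong (_* y) (sym (*-identityʳ p)))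
               (ratio-*-∤ pr p∤y h)
  ratio-*-prime^ {p} {y} {num} {den} pr p∤y α≤β h (suc e) =
    ratio-cong num≡ refl (sym (*-assoc p (p ^ suc e) y))
               (ratio-*-∣ α≤β (∣-trans (m∣m*n (p ^ e)) (m∣m*n y)) (ratio-*-prime^ pr p∤y α≤β h e))
    where
    num≡ : num * ((p ∸ 1) ^ β * p ^ (e * (β ∸ α))) * p ^ (β ∸ α) ≡ num * ((p ∸ 1) ^ β * p ^ (suc e * (β ∸ α)))
    num≡ = trans (solve 4 (λ a b c d → a :* (b :* c) :* d := a :* (b :* (d :* c))) refl
                          num ((p ∸ 1) ^ β) (p ^ (e * (β ∸ α))) (p ^ (β ∸ α)))
                 (cong (λ x → num * ((p ∸ 1) ^ β * x)) (sym (^-distribˡ-+-* p (β ∸ α) (e * (β ∸ α)))))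

  ratio-*-prime^⊓ : ∀ {p y num den} → Prime p → ¬ p ∣ y → α ≤ β → TotientRatio≥ α β num den y → ∀ T e →
                    TotientRatio≥ α β (num * primePowerNum α β p (e ⊓ suc T)) (den * primePowerDen α p (e ⊓ suc T)) (p ^ e * y)
  ratio-*-prime^⊓ {p} {y} {num} {den} pr p∤y α≤β h T zero =
    ratio-cong (sym (*-identityʳ num)) (sym (*-identityʳ den)) (sym (*-identityˡ y)) h
  ratio-*-prime^⊓ {p} {y} {num} {den} pr p∤y α≤β h T (suc e) =
    ratio-weakenˡ (*-monoʳ-≤ num (*-monoʳ-≤ ((p ∸ 1) ^ β) (^-monoʳ-≤ p (*-monoˡ-≤ (β ∸ α) (m⊓n≤m e T)))))
                  (ratio-*-prime^ pr p∤y α≤β h e)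
    where instance _ = prime⇒nonZero pr

-- Numbers without prime factors below 11

7≤10 : 7 ≤ 10
7≤10 = ≤ᵇ⇒≤ 7 10 tt

1+q^7-bound : ∀ q → 10 ≤ q → 513 * suc q ^ 7 ≤ q ^ 10
1+q^7-bound q 10≤q = *-cancelˡ-≤ (10 ^ 7) (begin
  10 ^ 7 * (513 * suc q ^ 7)  ≡⟨ pull 10 513 (suc q) ⟩
  513 * (10 * suc q) ^ 7      ≤⟨ *-monoʳ-≤ 513 (^-monoˡ-≤ 7 10[1+q]≤11q) ⟩
  513 * (11 * q) ^ 7          ≡⟨ push 513 11 q ⟩
  (513 * 11 ^ 7) * q ^ 7      ≤⟨ *-monoˡ-≤ (q ^ 7) (≤ᵇ⇒≤ (513 * 11 ^ 7) (10 ^ 10) tt) ⟩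
  10 ^ 10 * q ^ 7             ≡⟨ split 10 q ⟩
  10 ^ 7 * (10 ^ 3 * q ^ 7)   ≤⟨ *-monoʳ-≤ (10 ^ 7) (*-monoˡ-≤ (q ^ 7) (^-monoˡ-≤ 3 10≤q)) ⟩
  10 ^ 7 * (q ^ 3 * q ^ 7)    ≡⟨ cong (10 ^ 7 *_) (join q) ⟩
  10 ^ 7 * q ^ 10             ∎)
  where
  open ≤-Reasoning
  pull : ∀ t c x → t ^ 7 * (c * x ^ 7) ≡ c * (t * x) ^ 7
  pull = solve 3 (λ t c x → t :^ 7 :* (c :* x :^ 7) := c :* (t :* x) :^ 7) refl
  push : ∀ c t x → c * (t * x) ^ 7 ≡ (c * t ^ 7) * x ^ 7
  push = solve 3 (λ c t x → c :* (t :* x) :^ 7 := (c :* t :^ 7) :* x :^ 7) refl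
  split : ∀ t x → t ^ 10 * x ^ 7 ≡ t ^ 7 * (t ^ 3 * x ^ 7)
  split = solve 2 (λ t x → t :^ 10 :* x :^ 7 := t :^ 7 :* (t :^ 3 :* x :^ 7)) refl
  join : ∀ x → x ^ 3 * x ^ 7 ≡ x ^ 10
  join = solve 1 (λ x → x :^ 3 :* x :^ 7 := x :^ 10) refl
  10[1+q]≤11q : 10 * suc q ≤ 11 * q
  10[1+q]≤11q = begin
    10 * suc q   ≡⟨ *-suc 10 q ⟩
    10 + 10 * q  ≤⟨ +-monoˡ-≤ (10 * q) 10≤q ⟩
    q + 10 * q   ∎

ratio-*-large-prime-∤ : ∀ {p y} → Prime p → 11 ≤ p → ¬ p ∣ y →
                        TotientRatio≥ 7 10 1 1 y → TotientRatio≥ 7 10 513 1 (p * y)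
ratio-*-large-prime-∤ {p@(suc q)} pr (s≤s 10≤q) p∤y h = ratio-scale bound (ratio-*-∤ pr p∤y h)
  where
  instance _ = m*n≢0 1 (p ^ 7) {{_}} {{m^n≢0 p 7}}
  bound : 513 * (1 * p ^ 7) ≤ 1 * q ^ 10
  bound = subst₂ _≤_ (cong (513 *_) (sym (*-identityˡ (p ^ 7)))) (sym (*-identityˡ (q ^ 10))) (1+q^7-bound q 10≤q)

rough-*⇒≤ : ∀ {k p y} → Prime p → k Rough (p * y) → k ≤ p
rough-*⇒≤ pr r = rough⇒≤ {{prime⇒nonTrivial pr}} (rough∧∣⇒rough r (m∣m*n _))

ratio-rough-primeProduct : ∀ {p ps} → Prime p → All Prime ps → 11 Rough (p * product ps) →
                           TotientRatio≥ 7 10 513 1 (p * product ps)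
ratio-rough-primeProduct {p} {[]} pr [] r =
  ratio-*-large-prime-∤ pr (rough-*⇒≤ pr r) (λ p∣1 → ¬prime[1] (subst Prime (∣1⇒≡1 p∣1) pr)) ratio-1
ratio-rough-primeProduct {p} {q ∷ qs} pr (qpr ∷ qsprs) r = by-cases (p ∣? q * product qs)
  where
  ratio[q*qs] : TotientRatio≥ 7 10 513 1 (q * product qs)
  ratio[q*qs] = ratio-rough-primeProduct qpr qsprs (rough∧∣⇒rough r (n∣m*n p))
  by-cases : Dec (p ∣ q * product qs) → TotientRatio≥ 7 10 513 1 (p * (q * product qs))
  by-cases (yes p∣) = ratio-*-∣′ {{prime⇒nonZero pr}} 7≤10 p∣ ratio[q*qs]
  by-cases (no p∤)  = ratio-*-large-prime-∤ pr (rough-*⇒≤ pr r) p∤ (ratio-weakenˡ (s≤s z≤n) ratio[q*qs])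

ratio-rough : ∀ {n} .{{_ : NonZero n}} → 11 Rough n → n ≢ 1 → TotientRatio≥ 7 10 513 1 n
ratio-rough {n} r n≢1 with factorise n
... | record { factors = [] ; isFactorisation = n≡1 } = contradiction n≡1 n≢1
... | record { factors = p ∷ ps ; isFactorisation = n≡ ; factorsPrime = pr ∷ prs } =
  ratio-cong refl refl (sym n≡) (ratio-rough-primeProduct pr prs (subst (11 Rough_) n≡ r))

-- Splitting off the primes 2, 3, 5, 7

factor-out : ∀ p .{{_ : NonTrivial p}} n {{_ : NonZero n}} → ∃₂ λ e z → n ≡ p ^ e * z × ¬ p ∣ z × NonZero z
factor-out p n = go n (<-wellFounded n)
  where
  go : ∀ n {{_ : NonZero n}} → Acc _<_ n → ∃₂ λ e z → n ≡ p ^ e * z × ¬ p ∣ z × NonZero z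
  go n {{n≢0}} (acc rs) with p ∣? n
  ... | no p∤n  = 0 , n , sym (*-identityˡ n) , p∤n , n≢0
  ... | yes p∣n with go (quotient p∣n) {{quotient≢0 p∣n}} (rs (quotient-< p∣n))
  ...   | e , z , n/p≡ , p∤z , z≢0 = suc e , z , n≡ , p∤z , z≢0
    where
    n≡ : n ≡ p ^ suc e * z
    n≡ = begin
      n                 ≡⟨ m∣n⇒n≡m*quotient p∣n ⟩
      p * quotient p∣n  ≡⟨ cong (p *_) n/p≡ ⟩
      p * (p ^ e * z)   ≡⟨ *-assoc p (p ^ e) z ⟨
      p ^ suc e * z     ∎
      where open ≡-Reasoning

rough-step : ∀ {p y z} → p Rough y → z ∣ y → ¬ p ∣ z → suc p Rough z
rough-step r z∣y p∤z = ∤⇒rough-suc p∤z (rough∧∣⇒rough r z∣y)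

rough-skip : ∀ {k n} → Composite k → k Rough n → suc k Rough n
rough-skip c r = ∤⇒rough-suc (λ k∣n → r (hasNonTrivialDivisor-∣ c k∣n)) r

compose : (a b c d n : ℕ) → ℕ
compose a b c d n = 2 ^ a * (3 ^ b * (5 ^ c * (7 ^ d * n)))

record Decomposition (m : ℕ) : Set where
  field
    a b c d n : ℕ
    m≡        : m ≡ compose a b c d n
    ∤2        : ¬ 2 ∣ 3 ^ b * (5 ^ c * (7 ^ d * n))
    ∤3        : ¬ 3 ∣ 5 ^ c * (7 ^ d * n)
    ∤5        : ¬ 5 ∣ 7 ^ d * n
    ∤7        : ¬ 7 ∣ n
    rough     : 11 Rough n
    n≢0       : NonZero n

decompose : ∀ m {{_ : NonZero m}} → Decomposition m
decompose m with factor-out 2 m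
... | a , x₂ , m≡ , ∤2 , x₂≢0 with factor-out 3 x₂ {{x₂≢0}}
... | b , x₃ , refl , ∤3 , x₃≢0 with factor-out 5 x₃ {{x₃≢0}}
... | c , x₅ , refl , ∤5 , x₅≢0 with factor-out 7 x₅ {{x₅≢0}}
... | d , n , refl , ∤7 , n≢0 = record
  { a = a ; b = b ; c = c ; d = d ; n = n ; m≡ = m≡ ; ∤2 = ∤2 ; ∤3 = ∤3 ; ∤5 = ∤5 ; ∤7 = ∤7
  ; rough = rough ; n≢0 = n≢0 }
  where
  rough₃ : 3 Rough (3 ^ b * (5 ^ c * (7 ^ d * n)))
  rough₃ = rough-step 2-rough (subst (_ ∣_) (sym m≡) (n∣m*n (2 ^ a))) ∤2
  rough₅ : 5 Rough (5 ^ c * (7 ^ d * n))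
  rough₅ = rough-skip composite[4] (rough-step rough₃ (n∣m*n (3 ^ b)) ∤3)
  rough₇ : 7 Rough (7 ^ d * n)
  rough₇ = rough-skip composite[6] (rough-step rough₅ (n∣m*n (5 ^ c)) ∤5)
  rough : 11 Rough n
  rough = rough-skip (from-yes (composite? 10)) (rough-skip (from-yes (composite? 9))
            (rough-skip (from-yes (composite? 8)) (rough-step rough₇ (n∣m*n (7 ^ d)) ∤7)))

-- The finite check

smoothNum : (r a b c d : ℕ) → ℕ
smoothNum r a b c d = r * pn 7 d * pn 5 c * pn 3 b * pn 2 a
  where pn = primePowerNum 7 10

smoothDen : (a b c d : ℕ) → ℕ
smoothDen a b c d = 1 * pd 7 d * pd 5 c * pd 3 b * pd 2 a
  where pd = primePowerDen 7

ratio-decomposition : ∀ {m r} (D : Decomposition m) → TotientRatio≥ 7 10 r 1 (Decomposition.n D) →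
  let open Decomposition D in
  TotientRatio≥ 7 10 (smoothNum r (a ⊓ 4) (b ⊓ 3) (c ⊓ 2) (d ⊓ 2)) (smoothDen (a ⊓ 4) (b ⊓ 3) (c ⊓ 2) (d ⊓ 2)) m
ratio-decomposition D h = ratio-cong refl refl (sym m≡)
  (ratio-*-prime^⊓ prime[2] ∤2 7≤10 (ratio-*-prime^⊓ (from-yes (prime? 3)) ∤3 7≤10
    (ratio-*-prime^⊓ (from-yes (prime? 5)) ∤5 7≤10 (ratio-*-prime^⊓ (from-yes (prime? 7)) ∤7 7≤10 h 1 d) 1 c) 2 b) 3 a)
  where open Decomposition D

exceptions : List ℕ
exceptions = 3 ∷ 4 ∷ 6 ∷ 8 ∷ 10 ∷ 12 ∷ 14 ∷ 18 ∷ 20 ∷ 24 ∷ 30 ∷ 36 ∷ 42 ∷ 60 ∷ []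

-- 1 and 2 stand for the range m < 3 excluded by hypothesis.
Exceptional : (a b c d : ℕ) → Set
Exceptional a b c d = a < 4 × b < 3 × c < 2 × d < 2 × compose a b c d 1 ∈ 1 ∷ 2 ∷ exceptions

check-rough : ∀ {a} → a < 5 → ∀ {b} → b < 4 → ∀ {c} → c < 3 → ∀ {d} → d < 3 →
              smoothDen a b c d < smoothNum 513 a b c d
check-rough = from-yes (allUpTo? (λ a → allUpTo? (λ b → allUpTo? (λ c → allUpTo? (λ d →
                smoothDen a b c d <? smoothNum 513 a b c d) 3) 3) 4) 5)

check-smooth : ∀ {a} → a < 5 → ∀ {b} → b < 4 → ∀ {c} → c < 3 → ∀ {d} → d < 3 →
               smoothDen a b c d < smoothNum 1 a b c d ⊎ Exceptional a b c d
check-smooth = from-yes (allUpTo? (λ a → allUpTo? (λ b → allUpTo? (λ c → allUpTo? (λ d →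
                 (smoothDen a b c d <? smoothNum 1 a b c d) ⊎-dec
                 (a <? 4 ×-dec b <? 3 ×-dec c <? 2 ×-dec d <? 2 ×-dec compose a b c d 1 ∈? 1 ∷ 2 ∷ exceptions)) 3) 3) 4) 5)

⊓-<-suc : ∀ e k → e ⊓ k < suc k
⊓-<-suc e k = s≤s (m⊓n≤n e k)

⊓<⇒⊓≡ : ∀ {e k} → e ⊓ k < k → e ⊓ k ≡ e
⊓<⇒⊓≡ {e} {k} e⊓k<k with ⊓-sel e k
... | inj₁ e⊓k≡e = e⊓k≡e
... | inj₂ e⊓k≡k = contradiction e⊓k≡k (<⇒≢ e⊓k<k)

decomposition-exceptional : ∀ {m} (D : Decomposition m) → let open Decomposition D in
  n ≡ 1 → Exceptional (a ⊓ 4) (b ⊓ 3) (c ⊓ 2) (d ⊓ 2) → m ∈ 1 ∷ 2 ∷ exceptions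
decomposition-exceptional {m} D n≡1 (a< , b< , c< , d< , mem) = subst (_∈ 1 ∷ 2 ∷ exceptions) m′≡m mem
  where
  open Decomposition D
  open ≡-Reasoning
  m′≡m : compose (a ⊓ 4) (b ⊓ 3) (c ⊓ 2) (d ⊓ 2) 1 ≡ m
  m′≡m = begin
    compose (a ⊓ 4) (b ⊓ 3) (c ⊓ 2) (d ⊓ 2) 1
      ≡⟨ cong₂ (λ x y → compose x y (c ⊓ 2) (d ⊓ 2) 1) (⊓<⇒⊓≡ a<) (⊓<⇒⊓≡ b<) ⟩
    compose a b (c ⊓ 2) (d ⊓ 2) 1
      ≡⟨ cong₂ (λ x y → compose a b x y 1) (⊓<⇒⊓≡ c<) (⊓<⇒⊓≡ d<) ⟩
    compose a b c d 1                          ≡⟨ cong (compose a b c d) n≡1 ⟨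
    compose a b c d n                          ≡⟨ m≡ ⟨
    m                                          ∎

∈-drop-1-2 : ∀ {m xs} → 3 ≤ m → m ∈ 1 ∷ 2 ∷ xs → m ∈ xs
∈-drop-1-2 (s≤s ())       (here refl)
∈-drop-1-2 (s≤s (s≤s ())) (there (here refl))
∈-drop-1-2 _              (there (there m∈xs)) = m∈xs

corollary4p6 : (m : ℕ) → 3 ≤ m →
    ¬ (m ∈ 3 ∷ 4 ∷ 6 ∷ 8 ∷ 10 ∷ 12 ∷ 14 ∷ 18 ∷ 20 ∷ 24 ∷ 30 ∷ 36 ∷ 42 ∷ 60 ∷ []) →
    m ^ 7 < φ m ^ 10
corollary4p6 m 3≤m m∉ = by-cases (n ≟ 1)
  where
  instance _ = >-nonZero (≤-trans (s≤s z≤n) 3≤m)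
  D = decompose m
  open Decomposition D
  by-cases : Dec (n ≡ 1) → m ^ 7 < φ m ^ 10
  by-cases (no n≢1) = ratio⇒< (ratio-decomposition D (ratio-rough {{n≢0}} rough n≢1))
                              (check-rough (⊓-<-suc a 4) (⊓-<-suc b 3) (⊓-<-suc c 2) (⊓-<-suc d 2))
  by-cases (yes n≡1) = [ ratio⇒< (ratio-decomposition D ratio[n]) , excluded ]′
                         (check-smooth (⊓-<-suc a 4) (⊓-<-suc b 3) (⊓-<-suc c 2) (⊓-<-suc d 2))
    where
    ratio[n] : TotientRatio≥ 7 10 1 1 n
    ratio[n] = subst (TotientRatio≥ 7 10 1 1) (sym n≡1) ratio-1
    excluded : Exceptional (a ⊓ 4) (b ⊓ 3) (c ⊓ 2) (d ⊓ 2) → m ^ 7 < φ m ^ 10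
    excluded exc = contradiction (∈-drop-1-2 3≤m (decomposition-exceptional D n≡1 exc)) m∉
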